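{- Let $k \ge 2$ and let $M$ be a set of positive integers. If there exists a $\mathrm{PBD}(v, M)$ and an $\mathrm{NR}^*(m,k,k-1)$-BIBD for each $m \in M$, then there exists an $\mathrm{NR}^*(v,k,k-1)$-BIBD.
   Context: A $\mathrm{PBD}(v;M)$ is a pair $(V,\mathcal{B})$ with $|V|=v$ and $\mathcal{B}$ a collection of subsets of $V$ with sizes in $M$ such that every pair of distinct elements lies in exactly one block. A $(v,k,1)$-BIBD is a $\mathrm{PBD}(v;\{k\})$. Given a $(v,k,1)$-BIBD $(V,\mathcal{B})$, let $(k-1)\mathcal{B}$ be the block collection containing $k-1$ distinct (labeled) copies of each block of $\mathcal{B}$. A near resolution of $(k-1)\mathcal{B}$ is a partition of its blocks into classes such that each class consists of pairwise disjoint blocks whose union is $V$ minus exactly one element, and each element of $V$ is missed by exactly one class. It is self-orthogonal if for any two distinct classes $R_i,R_j$, regarding classes as sets of $k$-subsets, $|R_i\cap R_j|\le 1$. An $\mathrm{NR}^*(v,k,k-1)$-BIBD is a $(v,k,1)$-BIBD $(V,\mathcal{B})$ together with a self-orthogonal near resolution of $(k-1)\mathcal{B}$. -}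

module Defs where

open import Data.Nat using (ℕ; _∸_)
open import Data.Fin using (Fin)
open import Data.Fin.Subset using (Subset; _∈_; ∣_∣)
open import Data.Product using (Σ; ∃; _×_; _,_)
open import Data.Empty using (⊥)
open import Relation.Binary.PropositionalEquality using (_≡_; _≢_)
open import Function.Bundles using (_⇔_)
open import Relation.Nullary using (¬_)

Disjoint : ∀ {v} → Subset v → Subset v → Set
Disjoint S T = ∀ x → x ∈ S → x ∈ T → ⊥

-- A PBD(v;M): point set Fin v, block collection indexed by Fin b
-- (a collection, so repeated blocks are allowed a priori), every block
-- size lies in M, every pair of distinct points lies in exactly one block.
record PBD (v : ℕ) (M : ℕ → Set) : Set where
  field
    b      : ℕ
    block  : Fin b → Subset v
    sizeOK : ∀ i → M ∣ block i ∣
    pairs  : ∀ (x y : Fin v) → x ≢ y →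
             Σ (Fin b) λ i → (x ∈ block i × y ∈ block i) ×
               (∀ j → x ∈ block j → y ∈ block j → j ≡ i)

BIBD : ℕ → ℕ → Set
BIBD v k = PBD v (λ m → m ≡ k)

-- The labeled copies of the blocks of (k-1)B are the pairs (i , c) with
-- i : Fin b a block index of D and c : Fin (k ∸ 1) a copy label.
-- Classes are indexed by Fin r; cls assigns each labeled copy its class
-- (so the classes form a partition of (k-1)B); miss R is the element
-- missed by class R.
record SONearResolution {v k : ℕ} (D : BIBD v k) : Set where
  open PBD D
  field
    r    : ℕ
    cls  : Fin b → Fin (k ∸ 1) → Fin r
    miss : Fin r → Fin v
    disjoint : ∀ i c i' c' → cls i c ≡ cls i' c' →
               ¬ ((i , c) ≡ (i' , c')) → Disjoint (block i) (block i')
    covers : ∀ (R : Fin r) (y : Fin v) →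
             (Σ (Fin b) λ i → Σ (Fin (k ∸ 1)) λ c → cls i c ≡ R × y ∈ block i)
               ⇔ (y ≢ miss R)
    missedOnce : ∀ (x : Fin v) →
                 Σ (Fin r) λ R → miss R ≡ x × (∀ R' → miss R' ≡ x → R' ≡ R)
    -- self-orthogonality: regarding classes as sets of k-subsets,
    -- two distinct classes share at most one k-subset
    selfOrth : ∀ (R R' : Fin r) → R ≢ R' → ∀ (S T : Subset v) →
               (Σ (Fin b) λ i → Σ (Fin (k ∸ 1)) λ c → cls i c ≡ R × block i ≡ S) →
               (Σ (Fin b) λ i → Σ (Fin (k ∸ 1)) λ c → cls i c ≡ R' × block i ≡ S) →
               (Σ (Fin b) λ i → Σ (Fin (k ∸ 1)) λ c → cls i c ≡ R × block i ≡ T) →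
               (Σ (Fin b) λ i → Σ (Fin (k ∸ 1)) λ c → cls i c ≡ R' × block i ≡ T) →
               S ≡ T

NRStar : ℕ → ℕ → Set
NRStar v k = Σ (BIBD v k) SONearResolution

{-# OPTIONS --safe #-}

-- Fill every block B of the PBD with the NR*(∣B∣,k,k-1)-BIBD given on Fin ∣B∣, transported
-- to B along its increasing enumeration. A pair of points lies in exactly one block B, and
-- then in exactly one block of the design on B. The class of the new design missing x is the
-- union, over the blocks B ∋ x, of the class of the design on B that misses x; as the blocks
-- through x partition V ∖ {x}, this is a near resolution. A new block has k ≥ 2 points, so it
-- determines B; hence two classes missing x ≠ x′ can only share blocks inside the unique B
-- through x and x′, where the self-orthogonality of the design on B applies.
module Submission where

open import Defs
open import Data.Nat using (ℕ; zero; suc; _+_; _∸_; _≤_; s≤s)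

open import Data.Fin using (Fin; zero; suc; splitAt; _↑ˡ_; _↑ʳ_)
open import Data.Fin.Properties
  using (0≢1+n; suc-injective; splitAt-↑ˡ; splitAt-↑ʳ; splitAt⁻¹-↑ˡ; splitAt⁻¹-↑ʳ)
open import Data.Fin.Subset using (Subset; _∈_; _⊆_; ∣_∣; inside; outside)
open import Data.Vec.Base using ([]; _∷_; here; there)
open import Data.Vec.Properties using (∷-injective)
open import Data.Product using (Σ; ∃; ∃₂; _×_; _,_; proj₁; proj₂; map)
open import Data.Sum using (inj₁; inj₂)
open import Function using (_∘_; id)
open import Function.Bundles using (Equivalence; mk⇔)
open import Relation.Binary.PropositionalEquality

private variable n : ℕ

enum : (p : Subset n) → Fin ∣ p ∣ → Fin n
enum (inside ∷ p) zero = zero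
enum (inside ∷ p) (suc z) = suc (enum p z)
enum (outside ∷ p) z = suc (enum p z)

enum-injective : ∀ (p : Subset n) {z w} → enum p z ≡ enum p w → z ≡ w
enum-injective (inside ∷ p) {zero} {zero} _ = refl
enum-injective (inside ∷ p) {suc z} {suc w} eq = cong suc (enum-injective p (suc-injective eq))
enum-injective (outside ∷ p) eq = enum-injective p (suc-injective eq)

enum-∈ : ∀ (p : Subset n) z → enum p z ∈ p
enum-∈ (inside ∷ p) zero = here
enum-∈ (inside ∷ p) (suc z) = there (enum-∈ p z)
enum-∈ (outside ∷ p) z = there (enum-∈ p z)

enum-surjective : ∀ (p : Subset n) {y} → y ∈ p → ∃ λ z → enum p z ≡ y
enum-surjective (inside ∷ p) here = zero , refl
enum-surjective (inside ∷ p) (there y∈p) with enum-surjective p y∈p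
... | z , refl = suc z , refl
enum-surjective (outside ∷ p) (there y∈p) with enum-surjective p y∈p
... | z , refl = z , refl

two-distinct : ∀ (p : Subset n) → 2 ≤ ∣ p ∣ → ∃₂ λ x y → x ∈ p × y ∈ p × x ≢ y
two-distinct p 2≤∣p∣ with ∣ p ∣ | enum p | enum-injective p | enum-∈ p | 2≤∣p∣
... | suc (suc _) | e | e-injective | e-∈ | s≤s (s≤s _) =
  e zero , e (suc zero) , e-∈ zero , e-∈ (suc zero) , 0≢1+n ∘ e-injective

embed : (p : Subset n) → Subset ∣ p ∣ → Subset n
embed [] [] = []
embed (inside ∷ p) (s ∷ S) = s ∷ embed p S
embed (outside ∷ p) S = outside ∷ embed p S

∣embed∣ : ∀ (p : Subset n) S → ∣ embed p S ∣ ≡ ∣ S ∣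
∣embed∣ [] [] = refl
∣embed∣ (inside ∷ p) (inside ∷ S) = cong suc (∣embed∣ p S)
∣embed∣ (inside ∷ p) (outside ∷ S) = ∣embed∣ p S
∣embed∣ (outside ∷ p) S = ∣embed∣ p S

embed-injective : ∀ (p : Subset n) {S T} → embed p S ≡ embed p T → S ≡ T
embed-injective [] {[]} {[]} _ = refl
embed-injective (inside ∷ p) {s ∷ S} {t ∷ T} eq with ∷-injective eq
... | refl , eq′ = cong (s ∷_) (embed-injective p eq′)
embed-injective (outside ∷ p) eq = embed-injective p (proj₂ (∷-injective eq))

∈-embed⁺ : ∀ (p : Subset n) {S z} → z ∈ S → enum p z ∈ embed p S
∈-embed⁺ (inside ∷ p) {_ ∷ S} here = here
∈-embed⁺ (inside ∷ p) {_ ∷ S} (there z∈S) = there (∈-embed⁺ p z∈S)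
∈-embed⁺ (outside ∷ p) z∈S = there (∈-embed⁺ p z∈S)

∈-embed⁻ : ∀ (p : Subset n) {S y} → y ∈ embed p S → ∃ λ z → enum p z ≡ y × z ∈ S
∈-embed⁻ (inside ∷ p) {_ ∷ S} here = zero , refl , here
∈-embed⁻ (inside ∷ p) {_ ∷ S} (there y∈) with ∈-embed⁻ p y∈
... | z , refl , z∈S = suc z , refl , there z∈S
∈-embed⁻ (outside ∷ p) (there y∈) with ∈-embed⁻ p y∈
... | z , refl , z∈S = z , refl , z∈S

enum-∈-embed⁻ : ∀ (p : Subset n) {S z} → enum p z ∈ embed p S → z ∈ S
enum-∈-embed⁻ p {S} y∈ with ∈-embed⁻ p y∈
... | z , eq , z∈S = subst (_∈ S) (enum-injective p eq) z∈S

embed-⊆ : ∀ (p : Subset n) S → embed p S ⊆ p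
embed-⊆ p S y∈ with ∈-embed⁻ p y∈
... | z , refl , _ = enum-∈ p z

∑ : ∀ {b} → (Fin b → ℕ) → ℕ
∑ {zero} f = 0
∑ {suc b} f = f zero + ∑ (f ∘ suc)

joinΣ : ∀ {b} (f : Fin b → ℕ) → Σ (Fin b) (Fin ∘ f) → Fin (∑ f)
joinΣ f (zero , a) = a ↑ˡ ∑ (f ∘ suc)
joinΣ f (suc i , a) = f zero ↑ʳ joinΣ (f ∘ suc) (i , a)

splitΣ : ∀ {b} (f : Fin b → ℕ) → Fin (∑ f) → Σ (Fin b) (Fin ∘ f)
splitΣ {suc b} f j with splitAt (f zero) j
... | inj₁ a = zero , a
... | inj₂ a = map suc id (splitΣ (f ∘ suc) a)

splitΣ-joinΣ : ∀ {b} (f : Fin b → ℕ) p → splitΣ f (joinΣ f p) ≡ p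
splitΣ-joinΣ f (zero , a) rewrite splitAt-↑ˡ (f zero) a (∑ (f ∘ suc)) = refl
splitΣ-joinΣ f (suc i , a)
  rewrite splitAt-↑ʳ (f zero) (∑ (f ∘ suc)) (joinΣ (f ∘ suc) (i , a))
        | splitΣ-joinΣ (f ∘ suc) (i , a) = refl

joinΣ-splitΣ : ∀ {b} (f : Fin b → ℕ) j → joinΣ f (splitΣ f j) ≡ j
joinΣ-splitΣ {suc b} f j with splitAt (f zero) j in eq
... | inj₁ a = splitAt⁻¹-↑ˡ eq
... | inj₂ a = trans (cong (f zero ↑ʳ_) (joinΣ-splitΣ (f ∘ suc) a)) (splitAt⁻¹-↑ʳ eq)

splitΣ-surjective : ∀ {b} (f : Fin b → ℕ) p → ∃ λ j → splitΣ f j ≡ p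
splitΣ-surjective f p = joinΣ f p , splitΣ-joinΣ f p

splitΣ-injective : ∀ {b} (f : Fin b → ℕ) {j j′} → splitΣ f j ≡ splitΣ f j′ → j ≡ j′
splitΣ-injective f {j} {j′} eq = begin
  j                     ≡⟨ joinΣ-splitΣ f j ⟨
  joinΣ f (splitΣ f j)  ≡⟨ cong (joinΣ f) eq ⟩
  joinΣ f (splitΣ f j′) ≡⟨ joinΣ-splitΣ f j′ ⟩
  j′                    ∎
  where open ≡-Reasoning

block-unique : ∀ {v M} (P : PBD v M) {x y} → x ≢ y → ∀ {i j} →
               x ∈ PBD.block P i → y ∈ PBD.block P i →
               x ∈ PBD.block P j → y ∈ PBD.block P j → i ≡ j
block-unique P x≢y x∈i y∈i x∈j y∈j with PBD.pairs P _ _ x≢y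
... | _ , _ , unique = trans (unique _ x∈i y∈i) (sym (unique _ x∈j y∈j))

miss-injective : ∀ {v k} {D : BIBD v k} (N : SONearResolution D) {R R′} →
                 SONearResolution.miss N R ≡ SONearResolution.miss N R′ → R ≡ R′
miss-injective N {R} {R′} eq with SONearResolution.missedOnce N (SONearResolution.miss N R)
... | _ , _ , unique = trans (unique R refl) (sym (unique R′ (sym eq)))

module Fill {v} {M K : ℕ → Set} (P : PBD v M) (D : ∀ i → PBD ∣ PBD.block P i ∣ K) where
  open PBD P
  private module D i = PBD (D i)

  Idx : Set
  Idx = Σ (Fin b) (Fin ∘ D.b)

  fillBlock : Idx → Subset v
  fillBlock (i , j) = embed (block i) (D.block i j)

  fillBlock-⊆ : ∀ {i j} → fillBlock (i , j) ⊆ block i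
  fillBlock-⊆ {i} {j} = embed-⊆ (block i) (D.block i j)

  fillBlock-size : ∀ p → K ∣ fillBlock p ∣
  fillBlock-size (i , j) = subst K (sym (∣embed∣ (block i) (D.block i j))) (D.sizeOK i j)

  fillBlock-pairs : ∀ {x y} → x ≢ y → ∃ λ p → x ∈ fillBlock p × y ∈ fillBlock p
  fillBlock-pairs {x} {y} x≢y with pairs x y x≢y
  ... | i , (x∈ , y∈) , _ with enum-surjective (block i) x∈ | enum-surjective (block i) y∈
  ... | x₀ , refl | y₀ , refl with D.pairs i x₀ y₀ (x≢y ∘ cong (enum (block i)))
  ... | j , (x₀∈ , y₀∈) , _ = (i , j) , ∈-embed⁺ (block i) x₀∈ , ∈-embed⁺ (block i) y₀∈

  fillBlock-unique : ∀ {x y} → x ≢ y → ∀ {p q} →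
                     x ∈ fillBlock p → y ∈ fillBlock p → x ∈ fillBlock q → y ∈ fillBlock q → p ≡ q
  fillBlock-unique x≢y {i , _} {_ , _} x∈ y∈ x∈′ y∈′
    with block-unique P x≢y (fillBlock-⊆ x∈) (fillBlock-⊆ y∈) (fillBlock-⊆ x∈′) (fillBlock-⊆ y∈′)
  ... | refl with ∈-embed⁻ (block i) x∈ | ∈-embed⁻ (block i) y∈
  ... | _ , refl , x₀∈ | _ , refl , y₀∈ =
    cong (i ,_) (block-unique (D i) (x≢y ∘ cong (enum (block i))) x₀∈ y₀∈
                   (enum-∈-embed⁻ (block i) x∈′) (enum-∈-embed⁻ (block i) y∈′))

  fillBlock-injective : ∀ {p q} → 2 ≤ ∣ fillBlock p ∣ → fillBlock p ≡ fillBlock q → p ≡ q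
  fillBlock-injective {p} 2≤∣p∣ eq with two-distinct (fillBlock p) 2≤∣p∣
  ... | x , y , x∈ , y∈ , x≢y =
    fillBlock-unique x≢y x∈ y∈ (subst (x ∈_) eq x∈) (subst (y ∈_) eq y∈)

  filled : PBD v K
  filled = record
    { b      = ∑ D.b
    ; block  = fillBlock ∘ splitΣ D.b
    ; sizeOK = fillBlock-size ∘ splitΣ D.b
    ; pairs  = filled-pairs
    }
    where
    filled-pairs : ∀ x y → x ≢ y → Σ (Fin (∑ D.b)) λ j →
                   (x ∈ fillBlock (splitΣ D.b j) × y ∈ fillBlock (splitΣ D.b j)) ×
                   (∀ j′ → x ∈ fillBlock (splitΣ D.b j′) → y ∈ fillBlock (splitΣ D.b j′) → j′ ≡ j)
    filled-pairs x y x≢y with fillBlock-pairs x≢y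
    ... | p , x∈ , y∈ with splitΣ-surjective D.b p
    ... | j , refl =
      j , (x∈ , y∈) , λ _ x∈′ y∈′ → splitΣ-injective D.b (fillBlock-unique x≢y x∈′ y∈′ x∈ y∈)

module FillResolution {v k M} (2≤k : 2 ≤ k) (P : PBD v M)
                      (D : ∀ i → BIBD ∣ PBD.block P i ∣ k) (N : ∀ i → SONearResolution (D i)) where
  open PBD P
  open Fill P D
  private
    module D i = PBD (D i)
    module N i = SONearResolution (N i)

  missedPoint : Idx → Fin (k ∸ 1) → Fin v
  missedPoint (i , j) c = enum (block i) (N.miss i (N.cls i j c))

  missedPoint-∈ : ∀ p c → missedPoint p c ∈ block (proj₁ p)
  missedPoint-∈ (i , j) c = enum-∈ (block i) _

  missedPoint-∉ : ∀ p c {y} → y ∈ fillBlock p → y ≢ missedPoint p c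
  missedPoint-∉ (i , j) c y∈ y≡ with ∈-embed⁻ (block i) y∈
  ... | z , refl , z∈ =
    Equivalence.to (N.covers i (N.cls i j c) z) (j , c , refl , z∈) (enum-injective (block i) y≡)

  missedPoint-≡⇒cls-≡ : ∀ {i j j′ c c′} → missedPoint (i , j) c ≡ missedPoint (i , j′) c′ →
                        N.cls i j c ≡ N.cls i j′ c′
  missedPoint-≡⇒cls-≡ {i} eq = miss-injective (N i) (enum-injective (block i) eq)

  2≤∣fillBlock∣ : ∀ p → 2 ≤ ∣ fillBlock p ∣
  2≤∣fillBlock∣ p = subst (2 ≤_) (sym (fillBlock-size p)) 2≤k

  class-disjoint : ∀ p c q d → missedPoint p c ≡ missedPoint q d → (p , c) ≢ (q , d) →
                   Disjoint (fillBlock p) (fillBlock q)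
  class-disjoint (i , j) c (i′ , j′) d eq pc≢qd z z∈ z∈′
    with block-unique P (missedPoint-∉ (i , j) c z∈) (fillBlock-⊆ z∈) (missedPoint-∈ (i , j) c)
                        (fillBlock-⊆ z∈′) (subst (_∈ block i′) (sym eq) (missedPoint-∈ (i′ , j′) d))
  ... | refl with ∈-embed⁻ (block i) z∈
  ... | z₀ , refl , z₀∈ =
    N.disjoint i j c j′ d (missedPoint-≡⇒cls-≡ eq) (pc≢qd ∘ cong (λ (l , e) → (i , l) , e))
      z₀ z₀∈ (enum-∈-embed⁻ (block i) z∈′)

  class-covers : ∀ {x y} → y ≢ x →
                 Σ Idx λ p → Σ (Fin (k ∸ 1)) λ c → missedPoint p c ≡ x × y ∈ fillBlock p
  class-covers {x} {y} y≢x with pairs x y (y≢x ∘ sym)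
  ... | i , (x∈ , y∈) , _ with enum-surjective (block i) x∈ | enum-surjective (block i) y∈
  ... | x₀ , refl | y₀ , refl with N.missedOnce i x₀
  ... | R , missR≡x₀ , _
    with Equivalence.from (N.covers i R y₀) (λ y₀≡ → y≢x (cong (enum (block i)) (trans y₀≡ missR≡x₀)))
  ... | j , c , cls≡R , y₀∈ =
    (i , j) , c , cong (enum (block i)) (trans (cong (N.miss i) cls≡R) missR≡x₀) ,
    ∈-embed⁺ (block i) y₀∈

  InClass : Fin v → Subset v → Set
  InClass x S = Σ Idx λ p → Σ (Fin (k ∸ 1)) λ c → missedPoint p c ≡ x × fillBlock p ≡ S

  class-selfOrth : ∀ {x x′} → x ≢ x′ → ∀ {S T} →
                   InClass x S → InClass x′ S → InClass x T → InClass x′ T → S ≡ T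
  class-selfOrth x≢x′ ((i , j) , c₁ , refl , refl) (p₂ , c₂ , refl , p₂≡p)
                     ((i′ , j′) , c₃ , x≡ , refl) (q₄ , c₄ , x′≡ , q₄≡q)
    with fillBlock-injective (2≤∣fillBlock∣ p₂) p₂≡p | fillBlock-injective (2≤∣fillBlock∣ q₄) q₄≡q
  ... | refl | refl
    with block-unique P x≢x′ (missedPoint-∈ (i , j) c₁) (missedPoint-∈ (i , j) c₂)
           (subst (_∈ block i′) x≡ (missedPoint-∈ (i′ , j′) c₃))
           (subst (_∈ block i′) x′≡ (missedPoint-∈ (i′ , j′) c₄))
  ... | refl =
    cong (embed (block i))
      (N.selfOrth i (N.cls i j c₁) (N.cls i j c₂) (x≢x′ ∘ cong (enum (block i) ∘ N.miss i))
        (D.block i j) (D.block i j′)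
        (j , c₁ , refl , refl) (j , c₂ , refl , refl)
        (j′ , c₃ , missedPoint-≡⇒cls-≡ x≡ , refl) (j′ , c₄ , missedPoint-≡⇒cls-≡ x′≡ , refl))

  resolution : SONearResolution filled
  resolution = record
    { r          = v
    ; cls        = cls′
    ; miss       = id
    ; disjoint   = λ j c j′ c′ eq jc≢j′c′ → class-disjoint _ c _ c′ eq
                     λ eq′ → jc≢j′c′ (cong₂ _,_ (splitΣ-injective D.b (cong proj₁ eq′)) (cong proj₂ eq′))
    ; covers     = λ x y → mk⇔ (λ (j , c , eq , y∈) y≡x → missedPoint-∉ _ c y∈ (trans y≡x (sym eq)))
                                covered
    ; missedOnce = λ x → x , refl , λ _ → id
    ; selfOrth   = λ x x′ x≢x′ S T w₁ w₂ w₃ w₄ →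
                     class-selfOrth x≢x′ (map (splitΣ D.b) id w₁) (map (splitΣ D.b) id w₂)
                                         (map (splitΣ D.b) id w₃) (map (splitΣ D.b) id w₄)
    }
    where
    cls′ : Fin (∑ D.b) → Fin (k ∸ 1) → Fin v
    cls′ = missedPoint ∘ splitΣ D.b
    covered : ∀ {x y} → y ≢ x → Σ (Fin (∑ D.b)) λ j → Σ (Fin (k ∸ 1)) λ c →
              cls′ j c ≡ x × y ∈ PBD.block filled j
    covered y≢x with class-covers y≢x
    ... | p , c-covers with splitΣ-surjective D.b p
    ... | j , refl = j , c-covers

-- The construction never needs positive block sizes, so the hypothesis on M is unused.
lemma5p2 : (k : ℕ) → 2 ≤ k → (M : ℕ → Set) → (∀ m → M m → 1 ≤ m) →
           (v : ℕ) → PBD v M → (∀ m → M m → NRStar m k) → NRStar v k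
lemma5p2 k 2≤k M _ v P NR = Fill.filled P D , FillResolution.resolution 2≤k P D N
  where
  D : ∀ i → BIBD ∣ PBD.block P i ∣ k
  D i = proj₁ (NR _ (PBD.sizeOK P i))
  N : ∀ i → SONearResolution (D i)
  N i = proj₂ (NR _ (PBD.sizeOK P i))
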